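{- Let $\mathcal{M}$ be a matroid that is not Rayleigh but all of whose proper minors are Rayleigh. Let $e,f\in E(\mathcal{M})$ be distinct and let $y_c>0$ ($c\in E(\mathcal{M})$) be real numbers such that $\Delta M\{e,f\}(\mathbf{y})<0$. Then $\{e,f\}$ is a closed set (flat) of $\mathcal{M}$.
   Context: Let $\mathcal{M}$ be a matroid on a finite ground set $E$, with indeterminates $\mathbf{y}=\{y_c:c\in E\}$; for a basis $B$ write $\mathbf{y}^B=\prod_{e\in B}y_e$. For disjoint $I,J\subseteq E$ let $\mathcal{M}_I^J=\{B\setminus I : B \text{ a basis of } \mathcal{M},\ I\subseteq B\subseteq E\setminus J\}$ (empty if $I$ is dependent) and $M_I^J(\mathbf{y})=\sum_{A\in\mathcal{M}_I^J}\mathbf{y}^A$, writing e.g. $M_e^f=M_{\{e\}}^{\{f\}}$, $M_{ef}=M_{\{e,f\}}^{\emptyset}$, $M^{ef}=M_\emptyset^{\{e,f\}}$. For distinct $e,f$, $\Delta M\{e,f\}=M_e^fM_f^e-M_{ef}M^{ef}$. A matroid is Rayleigh if $\Delta M\{e,f\}(\mathbf{y})\ge0$ whenever all $y_c>0$ and $e\neq f$.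
   Formalization: The weights $y_c$, both those with $\Delta M\{e,f\}(\mathbf{y})<0$ and those quantified in the Rayleigh property of $\mathcal{M}$ and of its proper minors, are positive rationals rather than positive reals. -}

module Defs where

open import Data.Bool using (Bool; true; false; T; _∧_; not)
open import Data.Nat using (ℕ; zero; suc; _⊔_) renaming (_+_ to _+ℕ_; _≡ᵇ_ to _==_)
open import Data.Fin using (Fin)
open import Data.Fin.Subset using (Subset; _∈_; _∉_; _⊆_; _∩_; _∪_; _─_; ∁; ∣_∣; ⁅_⁆; Nonempty; ⊥)
open import Data.Vec using (Vec; []; _∷_; lookup)
open import Data.List using (List; []; _∷_; _++_; map; foldr; filterᵇ)
open import Data.Rational using (ℚ; 0ℚ; 1ℚ; _+_; _*_; _-_; _<_; _≤_)
open import Data.Product using (Σ; _×_; _,_; ∃)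
open import Relation.Binary.PropositionalEquality using (_≡_; _≢_)

allSubsets : (n : ℕ) → List (Subset n)
allSubsets zero    = [] ∷ []
allSubsets (suc n) = map (false ∷_) (allSubsets n) ++ map (true ∷_) (allSubsets n)

_⊆ᵇ_ : ∀ {n} → Subset n → Subset n → Bool
[] ⊆ᵇ [] = true
(true ∷ a) ⊆ᵇ (false ∷ b) = false
(_ ∷ a) ⊆ᵇ (_ ∷ b) = a ⊆ᵇ b

disjointᵇ : ∀ {n} → Subset n → Subset n → Bool
disjointᵇ a b = (a ∩ b) ⊆ᵇ ⊥

monomial : ∀ {n} → (Fin n → ℚ) → Subset n → ℚ
monomial {zero}  y []          = 1ℚ
monomial {suc n} y (true ∷ A)  = y Fin.zero * monomial (λ i → y (Fin.suc i)) A
monomial {suc n} y (false ∷ A) = monomial (λ i → y (Fin.suc i)) A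

sumℚ : List ℚ → ℚ
sumℚ = foldr _+_ 0ℚ

record Matroid (n : ℕ) : Set where
  field
    isBasis  : Subset n → Bool
    nonempty : ∃ λ B → T (isBasis B)
    exchange : ∀ B₁ B₂ x → T (isBasis B₁) → T (isBasis B₂) → x ∈ B₁ → x ∉ B₂ →
               ∃ λ z → z ∈ B₂ × z ∉ B₁ × T (isBasis ((B₁ ─ ⁅ x ⁆) ∪ ⁅ z ⁆))
open Matroid public

basesOf : ∀ {n} → (Subset n → Bool) → List (Subset n)
basesOf {n} 𝓑 = filterᵇ 𝓑 (allSubsets n)

rank : ∀ {n} → Matroid n → Subset n → ℕ
rank M S = foldr (λ B m → ∣ B ∩ S ∣ ⊔ m) 0 (basesOf (isBasis M))

IsFlat : ∀ {n} → Matroid n → Subset n → Set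
IsFlat M S = ∀ x → x ∉ S → rank M (S ∪ ⁅ x ⁆) ≢ rank M S

MIJ : ∀ {n} → (Subset n → Bool) → Subset n → Subset n → (Fin n → ℚ) → ℚ
MIJ 𝓑 I J y =
  sumℚ (map (λ B → monomial y (B ─ I))
            (filterᵇ (λ B → (I ⊆ᵇ B) ∧ disjointᵇ B J) (basesOf 𝓑)))

ΔM : ∀ {n} → (Subset n → Bool) → Fin n → Fin n → (Fin n → ℚ) → ℚ
ΔM 𝓑 e f y =
  MIJ 𝓑 ⁅ e ⁆ ⁅ f ⁆ y * MIJ 𝓑 ⁅ f ⁆ ⁅ e ⁆ y
  - MIJ 𝓑 (⁅ e ⁆ ∪ ⁅ f ⁆) ⊥ y * MIJ 𝓑 ⊥ (⁅ e ⁆ ∪ ⁅ f ⁆) y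

-- Rayleigh property of a set system of bases on the ground set G ⊆ Fin n
-- (all bases lie inside G; variables outside G do not occur)
RayleighOn : ∀ {n} → Subset n → (Subset n → Bool) → Set
RayleighOn {n} G 𝓑 = ∀ (e f : Fin n) → e ∈ G → f ∈ G → e ≢ f →
  (y : Fin n → ℚ) → (∀ c → 0ℚ < y c) → 0ℚ ≤ ΔM 𝓑 e f y

Rayleigh : ∀ {n} → Matroid n → Set
Rayleigh {n} M = RayleighOn (∁ ⊥) (isBasis M)

-- Minors M / C ∖ D (C, D disjoint), realised on the ground set E ∖ (C ∪ D)
-- X is a basis of M/C∖D iff X ⊆ E∖(C∪D), r(X ∪ C) = |X| + r(C),
-- and |X| + r(C) = r(E ∖ D).

minorBasis : ∀ {n} → Matroid n → Subset n → Subset n → Subset n → Bool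
minorBasis M C D X =
  (X ⊆ᵇ ∁ (C ∪ D))
  ∧ (rank M (X ∪ C) == (∣ X ∣ +ℕ rank M C))
  ∧ ((∣ X ∣ +ℕ rank M C) == rank M (∁ D))

ProperMinorsRayleigh : ∀ {n} → Matroid n → Set
ProperMinorsRayleigh {n} M = ∀ (C D : Subset n) → T (disjointᵇ C D) → Nonempty (C ∪ D) →
  RayleighOn (∁ (C ∪ D)) (minorBasis M C D)

-- Suppose g ∉ {e, f} satisfies r({e, f, g}) = r({e, f}); then no basis contains e, f and g.
-- If no basis contains both e and f, then M_{ef} = 0 and ΔM{e,f} = M_e^f M_f^e ≥ 0.
-- Otherwise some basis avoids g, so the bases of M ∖ g are the bases of M avoiding g.
-- Deletion–contraction at g gives M_e^f = a + y_g a′, M_f^e = b + y_g b′, M_{ef} = c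
-- (its y_g-part M_{efg} vanishes) and M^{ef} = d + y_g d′, where ab − cd = ΔM∖g{e,f} ≥ 0.
-- Hence ΔM{e,f} = (ab − cd) + y_g (ab′ + a′b − cd′) + y_g² a′b′, and cd′ ≤ ab′ + a′b holds
-- term by term: writing all six polynomials as sums over sets X avoiding e, f, g, a
-- basis-exchange argument shows that if X₁ + e + f and X₂ + g are bases, then so are
-- X₁ + f + g and X₂ + e, or X₁ + e + g and X₂ + f. So ΔM{e,f} ≥ 0, contradicting ΔM{e,f} < 0.

module Submission where

open import Defs
import Algebra.Solver.IdempotentCommutativeMonoid as ∪-Solver
open import Data.Bool using (Bool; true; false; T; not; _∧_; if_then_else_)
open import Data.Bool.Properties using (T-≡; T-∧; ∧-zeroʳ; ∧-comm)
import Data.Bool.Solver as BoolSolver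
open import Data.Empty using (⊥-elim)
open import Data.Fin using (Fin; zero; suc; _≟_)
open import Data.Fin.Properties using (any?)
open import Data.Fin.Subset using (Subset; _∈_; _∉_; _⊆_; _∩_; _∪_; _─_; ∁; ∣_∣; ⁅_⁆; ⊥)
open import Data.Fin.Subset.Properties
open import Data.List as List using (List; _++_; map; foldr; filterᵇ)
open import Data.List.Properties using (map-++; map-∘)
import Data.List.Relation.Unary.Any as Any
open import Data.List.Membership.Propositional using () renaming (_∈_ to _∈ˡ_)
open import Data.List.Membership.Propositional.Properties
  using (∈-map⁺; ∈-++⁺ˡ; ∈-++⁺ʳ; ∈-filter⁺; ∈-filter⁻)
open import Data.Nat as ℕ using (ℕ; zero; suc; _⊔_; _≡ᵇ_; z≤n)
import Data.Nat.Properties as ℕ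
open import Data.Nat.Induction using (<-wellFounded)
open import Data.Product as Product using (∃; _×_; _,_; proj₁; proj₂)
open import Data.Rational
  using (ℚ; 0ℚ; 1ℚ; _+_; _*_; _-_; -_; _<_; _≤_; positive; nonNegative)
open import Data.Rational.Properties
  using (+-identityˡ; +-identityʳ; +-comm; +-assoc; +-mono-≤; +-monoˡ-≤; +-inverseʳ;
         *-zeroˡ; *-zeroʳ; *-comm; *-distribˡ-+; ≤-refl; <⇒≤; <-irrefl; ≤-<-trans;
         positive⁻¹; nonNegative⁻¹; pos*pos⇒pos; nonNeg*nonNeg⇒nonNeg)
import Data.Rational.Solver as ℚSolver
open import Data.Sum as Sum using (_⊎_; inj₁; inj₂; [_,_])
open import Data.Unit using (tt)
open import Data.Vec using ([]; _∷_; lookup; here; there)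
open import Data.Vec.Properties using ([]=⇒lookup; lookup⇒[]=)
open import Function using (_∘_; _⇔_; mk⇔; Equivalence)
open import Induction.WellFounded using (Acc; acc)
open import Relation.Binary.PropositionalEquality
  using (_≡_; _≢_; refl; sym; trans; cong; cong₂; subst; subst₂; module ≡-Reasoning)
open import Relation.Nullary using (¬_; yes; no; ¬?; contradiction)
open import Relation.Nullary.Decidable using (T?; _×-dec_; decidable-stable)

private
  variable
    n : ℕ
    p q B C P : Subset n
    x y z : Fin n

x∈p─q⇒x∉q : ∀ (p q : Subset n) → x ∈ p ─ q → x ∉ q
x∈p─q⇒x∉q (true ∷ p) (false ∷ q) here ()
x∈p─q⇒x∉q (_ ∷ p) (_ ∷ q) (there x∈p─q) (there x∈q) = x∈p─q⇒x∉q p q x∈p─q x∈q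

x∈p─q⁻ : ∀ (p q : Subset n) → x ∈ p ─ q → x ∈ p × x ∉ q
x∈p─q⁻ p q x∈p─q = p─q⊆p p q x∈p─q , x∈p─q⇒x∉q p q x∈p─q

x∉p∪q : x ∉ p → x ∉ q → x ∉ p ∪ q
x∉p∪q {p = p} {q = q} x∉p x∉q x∈p∪q with x∈p∪q⁻ p q x∈p∪q
... | inj₁ x∈p = x∉p x∈p
... | inj₂ x∈q = x∉q x∈q

p∪q⊆r : ∀ {r : Subset n} → p ⊆ r → q ⊆ r → p ∪ q ⊆ r
p∪q⊆r {p = p} {q = q} p⊆r q⊆r x∈p∪q with x∈p∪q⁻ p q x∈p∪q
... | inj₁ x∈p = p⊆r x∈p
... | inj₂ x∈q = q⊆r x∈q

x∈p⇒⁅x⁆⊆p : x ∈ p → ⁅ x ⁆ ⊆ p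
x∈p⇒⁅x⁆⊆p {x = x} x∈p y∈⁅x⁆ rewrite x∈⁅y⁆⇒x≡y x y∈⁅x⁆ = x∈p

x∈⁅x⁆∪⁅y⁆ : ∀ (x y : Fin n) → x ∈ ⁅ x ⁆ ∪ ⁅ y ⁆
x∈⁅x⁆∪⁅y⁆ x y = x∈p∪q⁺ (inj₁ (x∈⁅x⁆ x))

y∈⁅x⁆∪⁅y⁆ : ∀ (x y : Fin n) → y ∈ ⁅ x ⁆ ∪ ⁅ y ⁆
y∈⁅x⁆∪⁅y⁆ x y = x∈p∪q⁺ (inj₂ (x∈⁅x⁆ y))

z∈⁅x⁆∪⁅y⁆⁻ : z ∈ ⁅ x ⁆ ∪ ⁅ y ⁆ → z ≡ x ⊎ z ≡ y
z∈⁅x⁆∪⁅y⁆⁻ {x = x} {y = y} z∈ with x∈p∪q⁻ ⁅ x ⁆ ⁅ y ⁆ z∈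
... | inj₁ z∈⁅x⁆ = inj₁ (x∈⁅y⁆⇒x≡y x z∈⁅x⁆)
... | inj₂ z∈⁅y⁆ = inj₂ (x∈⁅y⁆⇒x≡y y z∈⁅y⁆)

⁅x⁆∪⁅y⁆⊆p : x ∈ p → y ∈ p → ⁅ x ⁆ ∪ ⁅ y ⁆ ⊆ p
⁅x⁆∪⁅y⁆⊆p x∈p y∈p = p∪q⊆r (x∈p⇒⁅x⁆⊆p x∈p) (x∈p⇒⁅x⁆⊆p y∈p)

⁅x⁆#⁅y⁆∪⁅z⁆ : ∀ {w : Fin n} → x ≢ y → x ≢ z → w ∈ ⁅ x ⁆ → w ∉ ⁅ y ⁆ ∪ ⁅ z ⁆
⁅x⁆#⁅y⁆∪⁅z⁆ {x = x} x≢y x≢z w∈⁅x⁆ rewrite x∈⁅y⁆⇒x≡y x w∈⁅x⁆ =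
  x∉p∪q (x≢y⇒x∉⁅y⁆ x≢y) (x≢y⇒x∉⁅y⁆ x≢z)

⁅x⁆∪⁅y⁆#⁅z⁆ : ∀ {w : Fin n} → x ≢ z → y ≢ z → w ∈ ⁅ x ⁆ ∪ ⁅ y ⁆ → w ∉ ⁅ z ⁆
⁅x⁆∪⁅y⁆#⁅z⁆ x≢z y≢z w∈ with z∈⁅x⁆∪⁅y⁆⁻ w∈
... | inj₁ refl = x≢y⇒x∉⁅y⁆ x≢z
... | inj₂ refl = x≢y⇒x∉⁅y⁆ y≢z

⊆∁⁅x⁆ : x ∉ p → p ⊆ ∁ ⁅ x ⁆
⊆∁⁅x⁆ {x = x} {p = p} x∉p y∈p = x∉p⇒x∈∁p λ y∈⁅x⁆ → x∉p (subst (_∈ p) (x∈⁅y⁆⇒x≡y x y∈⁅x⁆) y∈p)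

∈⇔lookup : x ∈ p ⇔ T (lookup p x)
∈⇔lookup {x = x} {p = p} = mk⇔
  (λ x∈p → Equivalence.from T-≡ ([]=⇒lookup x∈p))
  (λ t → lookup⇒[]= x p (Equivalence.to T-≡ t))

⊆⊎∃∉ : ∀ (p q : Subset n) → p ⊆ q ⊎ ∃ λ x → x ∈ p × x ∉ q
⊆⊎∃∉ p q with any? (λ x → x ∈? p ×-dec ¬? (x ∈? q))
... | yes (x , x∈p , x∉q) = inj₂ (x , x∈p , x∉q)
... | no ∄ = inj₁ λ {x} x∈p → decidable-stable (x ∈? q) (λ x∉q → ∄ (x , x∈p , x∉q))

p∪⁅x⁆─⁅x⁆≡p : x ∉ p → (p ∪ ⁅ x ⁆) ─ ⁅ x ⁆ ≡ p
p∪⁅x⁆─⁅x⁆≡p {x = x} {p = p} x∉p = ⊆-antisym ⊆p p⊆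
  where
  ⊆p : (p ∪ ⁅ x ⁆) ─ ⁅ x ⁆ ⊆ p
  ⊆p i∈ with x∈p─q⁻ (p ∪ ⁅ x ⁆) ⁅ x ⁆ i∈
  ... | i∈p∪⁅x⁆ , i∉⁅x⁆ with x∈p∪q⁻ p ⁅ x ⁆ i∈p∪⁅x⁆
  ...   | inj₁ i∈p   = i∈p
  ...   | inj₂ i∈⁅x⁆ = contradiction i∈⁅x⁆ i∉⁅x⁆
  p⊆ : p ⊆ (p ∪ ⁅ x ⁆) ─ ⁅ x ⁆
  p⊆ i∈p = x∈p∧x∉q⇒x∈p─q (p⊆p∪q ⁅ x ⁆ i∈p) λ i∈⁅x⁆ → x∉p (subst (_∈ p) (x∈⁅y⁆⇒x≡y x i∈⁅x⁆) i∈p)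

∣p∪⁅x⁆∣≡1+∣p∣ : ∀ (p : Subset n) → x ∉ p → ∣ p ∪ ⁅ x ⁆ ∣ ≡ suc ∣ p ∣
∣p∪⁅x⁆∣≡1+∣p∣ {x = zero}  (true ∷ p)  x∉p = contradiction here x∉p
∣p∪⁅x⁆∣≡1+∣p∣ {x = zero}  (false ∷ p) x∉p = cong (suc ∘ ∣_∣) (∪-identityʳ p)
∣p∪⁅x⁆∣≡1+∣p∣ {x = suc x} (true ∷ p)  x∉p = cong suc (∣p∪⁅x⁆∣≡1+∣p∣ p (x∉p ∘ there))
∣p∪⁅x⁆∣≡1+∣p∣ {x = suc x} (false ∷ p) x∉p = ∣p∪⁅x⁆∣≡1+∣p∣ p (x∉p ∘ there)

⊆∧∣∣≥⇒≡ : p ⊆ q → ∣ q ∣ ℕ.≤ ∣ p ∣ → p ≡ q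
⊆∧∣∣≥⇒≡ {p = p} {q = q} p⊆q ∣q∣≤∣p∣ with ⊆⊎∃∉ q p
... | inj₁ q⊆p = ⊆-antisym p⊆q q⊆p
... | inj₂ (x , x∈q , x∉p) = contradiction (p⊂q⇒∣p∣<∣q∣ (p⊆q , x , x∈q , x∉p)) (ℕ.≤⇒≯ ∣q∣≤∣p∣)

replace : Subset n → Fin n → Fin n → Subset n
replace B x z = (B ─ ⁅ x ⁆) ∪ ⁅ z ⁆

z∈replace : ∀ (B : Subset n) x z → z ∈ replace B x z
z∈replace B x z = x∈p∪q⁺ (inj₂ (x∈⁅x⁆ z))

∈-replace⁺ : ∀ {i} → i ∈ B → i ≢ x → i ∈ replace B x z
∈-replace⁺ i∈B i≢x = x∈p∪q⁺ (inj₁ (x∈p∧x≢y⇒x∈p-y i∈B i≢x))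

∈-replace⁻ : ∀ {i} → i ∈ replace B x z → i ≡ z ⊎ (i ∈ B × i ≢ x)
∈-replace⁻ {B = B} {x = x} {z = z} i∈ with x∈p∪q⁻ (B ─ ⁅ x ⁆) ⁅ z ⁆ i∈
... | inj₂ i∈⁅z⁆ = inj₁ (x∈⁅y⁆⇒x≡y z i∈⁅z⁆)
... | inj₁ i∈B─x with x∈p─q⁻ B ⁅ x ⁆ i∈B─x
...   | i∈B , i∉⁅x⁆ = inj₂ (i∈B , x∉⁅y⁆⇒x≢y i∉⁅x⁆)

x∉replace : x ≢ z → x ∉ replace B x z
x∉replace x≢z x∈ with ∈-replace⁻ x∈
... | inj₁ x≡z = x≢z x≡z
... | inj₂ (_ , x≢x) = x≢x refl

replace-self : x ∈ B → replace B x x ≡ B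
replace-self {x = x} {B = B} x∈B = ⊆-antisym ⊆B B⊆
  where
  ⊆B : replace B x x ⊆ B
  ⊆B i∈ with ∈-replace⁻ i∈
  ... | inj₁ refl = x∈B
  ... | inj₂ (i∈B , _) = i∈B
  B⊆ : B ⊆ replace B x x
  B⊆ {i} i∈B with i ≟ x
  ... | yes refl = z∈replace B x x
  ... | no i≢x = ∈-replace⁺ i∈B i≢x

replace-∪⁅x⁆ : x ∉ p → replace (p ∪ ⁅ x ⁆) x z ≡ p ∪ ⁅ z ⁆
replace-∪⁅x⁆ {z = z} x∉p = cong (_∪ ⁅ z ⁆) (p∪⁅x⁆─⁅x⁆≡p x∉p)

replace-∪⁅x⁆∪⁅y⁆ˡ : ∀ {n} {p : Subset n} {x y z} → x ∉ p → x ≢ y →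
                    replace (p ∪ ⁅ x ⁆ ∪ ⁅ y ⁆) x z ≡ p ∪ ⁅ y ⁆ ∪ ⁅ z ⁆
replace-∪⁅x⁆∪⁅y⁆ˡ {n} {p} {x} {y} {z} x∉p x≢y = begin
  replace (p ∪ ⁅ x ⁆ ∪ ⁅ y ⁆) x z   ≡⟨ cong (λ B → replace B x z) (swap p ⁅ x ⁆ ⁅ y ⁆) ⟩
  replace ((p ∪ ⁅ y ⁆) ∪ ⁅ x ⁆) x z ≡⟨ replace-∪⁅x⁆ (x∉p∪q x∉p (x≢y⇒x∉⁅y⁆ x≢y)) ⟩
  (p ∪ ⁅ y ⁆) ∪ ⁅ z ⁆               ≡⟨ ∪-assoc p ⁅ y ⁆ ⁅ z ⁆ ⟩
  p ∪ ⁅ y ⁆ ∪ ⁅ z ⁆                 ∎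
  where
  open ≡-Reasoning
  open ∪-Solver (∪-idempotentCommutativeMonoid n)
  swap : ∀ (a b c : Subset n) → a ∪ b ∪ c ≡ (a ∪ c) ∪ b
  swap = solve 3 (λ a b c → a ⊕ (b ⊕ c) ⊜ (a ⊕ c) ⊕ b) refl

replace-∪⁅x⁆∪⁅y⁆ʳ : ∀ {n} {p : Subset n} {x y z} → y ∉ p → x ≢ y →
                    replace (p ∪ ⁅ x ⁆ ∪ ⁅ y ⁆) y z ≡ p ∪ ⁅ x ⁆ ∪ ⁅ z ⁆
replace-∪⁅x⁆∪⁅y⁆ʳ {p = p} {x} {y} {z} y∉p x≢y = begin
  replace (p ∪ ⁅ x ⁆ ∪ ⁅ y ⁆) y z   ≡⟨ cong (λ B → replace B y z) (∪-assoc p ⁅ x ⁆ ⁅ y ⁆) ⟨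
  replace ((p ∪ ⁅ x ⁆) ∪ ⁅ y ⁆) y z ≡⟨ replace-∪⁅x⁆ (x∉p∪q y∉p (x≢y⇒x∉⁅y⁆ (x≢y ∘ sym))) ⟩
  (p ∪ ⁅ x ⁆) ∪ ⁅ z ⁆               ≡⟨ ∪-assoc p ⁅ x ⁆ ⁅ z ⁆ ⟩
  p ∪ ⁅ x ⁆ ∪ ⁅ z ⁆                 ∎
  where open ≡-Reasoning

∣replace∣≡∣B∣ : x ∈ B → z ∉ B → ∣ replace B x z ∣ ≡ ∣ B ∣
∣replace∣≡∣B∣ {x = x} {B = B} {z = z} x∈B z∉B = begin
  ∣ replace B x z ∣      ≡⟨ ∣p∪⁅x⁆∣≡1+∣p∣ (B ─ ⁅ x ⁆) (z∉B ∘ p─q⊆p B ⁅ x ⁆) ⟩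
  suc ∣ B ─ ⁅ x ⁆ ∣      ≡⟨ ∣p∪⁅x⁆∣≡1+∣p∣ (B ─ ⁅ x ⁆) (λ x∈ → x∈p─q⇒x∉q B ⁅ x ⁆ x∈ (x∈⁅x⁆ x)) ⟨
  ∣ replace B x x ∣      ≡⟨ cong ∣_∣ (replace-self x∈B) ⟩
  ∣ B ∣                  ∎
  where open ≡-Reasoning

∣replace─∣<∣─∣ : x ∈ C → x ∉ B → z ∈ B → ∣ replace C x z ─ B ∣ ℕ.< ∣ C ─ B ∣
∣replace─∣<∣─∣ {x = x} {C = C} {B = B} {z = z} x∈C x∉B z∈B =
  p⊂q⇒∣p∣<∣q∣ (⊆C─B , x , x∈p∧x∉q⇒x∈p─q x∈C x∉B , x∉replace x≢z ∘ p─q⊆p _ B)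
  where
  x≢z : x ≢ z
  x≢z refl = x∉B z∈B
  ⊆C─B : replace C x z ─ B ⊆ C ─ B
  ⊆C─B i∈ with x∈p─q⁻ (replace C x z) B i∈
  ... | i∈R , i∉B with ∈-replace⁻ i∈R
  ...   | inj₁ refl = contradiction z∈B i∉B
  ...   | inj₂ (i∈C , _) = x∈p∧x∉q⇒x∈p─q i∈C i∉B

T-injective : ∀ {a b} → (T a → T b) → (T b → T a) → a ≡ b
T-injective {false} {false} _   _   = refl
T-injective {false} {true}  _   b⇒a = ⊥-elim (b⇒a tt)
T-injective {true}  {false} a⇒b _   = ⊥-elim (a⇒b tt)
T-injective {true}  {true}  _   _   = refl

⊆ᵇ-sound : ∀ (p q : Subset n) → T (p ⊆ᵇ q) → p ⊆ q
⊆ᵇ-sound (true ∷ p)  (true ∷ q) t here        = here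
⊆ᵇ-sound (true ∷ p)  (true ∷ q) t (there x∈p) = there (⊆ᵇ-sound p q t x∈p)
⊆ᵇ-sound (false ∷ p) (_ ∷ q)    t (there x∈p) = there (⊆ᵇ-sound p q t x∈p)

⊆ᵇ-complete : ∀ (p q : Subset n) → p ⊆ q → T (p ⊆ᵇ q)
⊆ᵇ-complete []          []          _   = tt
⊆ᵇ-complete (true ∷ p)  (false ∷ q) p⊆q with p⊆q here
... | ()
⊆ᵇ-complete (true ∷ p)  (true ∷ q)  p⊆q = ⊆ᵇ-complete p q (drop-∷-⊆ p⊆q)
⊆ᵇ-complete (false ∷ p) (_ ∷ q)     p⊆q = ⊆ᵇ-complete p q (drop-∷-⊆ p⊆q)

disjointᵇ-sound : ∀ (p q : Subset n) → T (disjointᵇ p q) → x ∈ p → x ∉ q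
disjointᵇ-sound p q t x∈p x∈q = ∉⊥ (⊆ᵇ-sound (p ∩ q) ⊥ t (x∈p∩q⁺ (x∈p , x∈q)))

disjointᵇ-complete : ∀ (p q : Subset n) → (∀ {x} → x ∈ p → x ∉ q) → T (disjointᵇ p q)
disjointᵇ-complete p q p#q = ⊆ᵇ-complete (p ∩ q) ⊥ λ x∈p∩q →
  let x∈p , x∈q = x∈p∩q⁻ p q x∈p∩q in contradiction x∈q (p#q x∈p)

⊥-⊆ᵇ : ∀ (p : Subset n) → ⊥ ⊆ᵇ p ≡ true
⊥-⊆ᵇ p = Equivalence.to T-≡ (⊆ᵇ-complete ⊥ p ⊥⊆)

∪-⊆ᵇ : ∀ (p q r : Subset n) → (p ∪ q) ⊆ᵇ r ≡ (p ⊆ᵇ r) ∧ (q ⊆ᵇ r)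
∪-⊆ᵇ []          []          []          = refl
∪-⊆ᵇ (true ∷ p)  (_ ∷ q)     (false ∷ r) = refl
∪-⊆ᵇ (false ∷ p) (true ∷ q)  (false ∷ r) = sym (∧-zeroʳ _)
∪-⊆ᵇ (false ∷ p) (false ∷ q) (false ∷ r) = ∪-⊆ᵇ p q r
∪-⊆ᵇ (true ∷ p)  (true ∷ q)  (true ∷ r)  = ∪-⊆ᵇ p q r
∪-⊆ᵇ (true ∷ p)  (false ∷ q) (true ∷ r)  = ∪-⊆ᵇ p q r
∪-⊆ᵇ (false ∷ p) (true ∷ q)  (true ∷ r)  = ∪-⊆ᵇ p q r
∪-⊆ᵇ (false ∷ p) (false ∷ q) (true ∷ r)  = ∪-⊆ᵇ p q r

⁅x⁆-⊆ᵇ : ∀ x (p : Subset n) → ⁅ x ⁆ ⊆ᵇ p ≡ lookup p x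
⁅x⁆-⊆ᵇ zero    (true ∷ p)  = ⊥-⊆ᵇ p
⁅x⁆-⊆ᵇ zero    (false ∷ p) = refl
⁅x⁆-⊆ᵇ (suc x) (_ ∷ p)     = ⁅x⁆-⊆ᵇ x p

⊆ᵇ-∁ : ∀ (p q : Subset n) → p ⊆ᵇ ∁ q ≡ disjointᵇ p q
⊆ᵇ-∁ []          []          = refl
⊆ᵇ-∁ (true ∷ p)  (true ∷ q)  = refl
⊆ᵇ-∁ (true ∷ p)  (false ∷ q) = ⊆ᵇ-∁ p q
⊆ᵇ-∁ (false ∷ p) (true ∷ q)  = ⊆ᵇ-∁ p q
⊆ᵇ-∁ (false ∷ p) (false ∷ q) = ⊆ᵇ-∁ p q

disjointᵇ-∪ʳ : ∀ (p q r : Subset n) → disjointᵇ p (q ∪ r) ≡ disjointᵇ p q ∧ disjointᵇ p r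
disjointᵇ-∪ʳ p q r = trans (cong (_⊆ᵇ ⊥) (∩-distribˡ-∪ p q r)) (∪-⊆ᵇ (p ∩ q) (p ∩ r) ⊥)

disjointᵇ-⁅x⁆ : ∀ {n} (p : Subset n) x → disjointᵇ p ⁅ x ⁆ ≡ not (lookup p x)
disjointᵇ-⁅x⁆ (true ∷ p)          zero    = refl
disjointᵇ-⁅x⁆ {suc n} (false ∷ p) zero    = trans (cong (_⊆ᵇ ⊥) (∩-zeroʳ p)) (⊥-⊆ᵇ (⊥ {n}))
disjointᵇ-⁅x⁆ (true ∷ p)          (suc x) = disjointᵇ-⁅x⁆ p x
disjointᵇ-⁅x⁆ (false ∷ p)         (suc x) = disjointᵇ-⁅x⁆ p x

-- Bases

IsBasis : Matroid n → Subset n → Set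
IsBasis M B = T (isBasis M B)

module _ (M : Matroid n) where

  exchange-towards : IsBasis M B → IsBasis M C → P ⊆ C →
    ∃ λ C′ → IsBasis M C′ × P ⊆ C′ × C′ ─ B ⊆ P × ∣ C′ ∣ ≡ ∣ C ∣
  exchange-towards {B} {C} {P} isB isC P⊆C = go C (<-wellFounded _) isC P⊆C
    where
    go : ∀ C → Acc ℕ._<_ ∣ C ─ B ∣ → IsBasis M C → P ⊆ C →
         ∃ λ C′ → IsBasis M C′ × P ⊆ C′ × C′ ─ B ⊆ P × ∣ C′ ∣ ≡ ∣ C ∣
    go C (acc rec) isC P⊆C with ⊆⊎∃∉ (C ─ B) P
    ... | inj₁ C─B⊆P = C , isC , P⊆C , C─B⊆P , refl
    ... | inj₂ (x , x∈C─B , x∉P) with x∈p─q⁻ C B x∈C─B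
    ...   | x∈C , x∉B with exchange M C B x isC isB x∈C x∉B
    ...     | z , z∈B , z∉C , isC[x↦z] =
      let C′ , isC′ , P⊆C′ , C′─B⊆P , ∣C′∣≡ =
            go (replace C x z) (rec (∣replace─∣<∣─∣ x∈C x∉B z∈B)) isC[x↦z]
               (λ p∈P → ∈-replace⁺ (P⊆C p∈P) λ p≡x → x∉P (subst (_∈ P) p≡x p∈P))
      in C′ , isC′ , P⊆C′ , C′─B⊆P , trans ∣C′∣≡ (∣replace∣≡∣B∣ x∈C z∉C)

  exchange-or-extend : IsBasis M B → IsBasis M C → P ⊆ C → x ∈ B →
    (∃ λ C′ → IsBasis M C′ × P ⊆ C′ × x ∈ C′) ⊎
    (∃ λ z → z ∈ P × z ∉ B × IsBasis M (replace B x z))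
  exchange-or-extend {B} {x = x} isB isC P⊆C x∈B with exchange-towards isB isC P⊆C
  ... | C′ , isC′ , P⊆C′ , C′─B⊆P , _ with x ∈? C′
  ...   | yes x∈C′ = inj₁ (C′ , isC′ , P⊆C′ , x∈C′)
  ...   | no x∉C′ with exchange M B C′ x isB isC′ x∈B x∉C′
  ...     | z , z∈C′ , z∉B , isB[x↦z] = inj₂ (z , C′─B⊆P (x∈p∧x∉q⇒x∈p─q z∈C′ z∉B) , z∉B , isB[x↦z])

  bases-equicardinal : IsBasis M B → IsBasis M C → ∣ B ∣ ≡ ∣ C ∣
  bases-equicardinal {B} {C} isB isC with exchange-towards isB isC ⊥⊆
  ... | C′ , isC′ , _ , C′─B⊆⊥ , ∣C′∣≡∣C∣ = trans (cong ∣_∣ (⊆-antisym B⊆C′ C′⊆B)) ∣C′∣≡∣C∣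
    where
    C′⊆B : C′ ⊆ B
    C′⊆B {i} i∈C′ = decidable-stable (i ∈? B) λ i∉B → ∉⊥ (C′─B⊆⊥ (x∈p∧x∉q⇒x∈p─q i∈C′ i∉B))
    B⊆C′ : B ⊆ C′
    B⊆C′ {i} i∈B = decidable-stable (i ∈? C′) λ i∉C′ →
      let z , z∈C′ , z∉B , _ = exchange M B C′ i isB isC′ i∈B i∉C′ in z∉B (C′⊆B z∈C′)

module _ (M : Matroid n) where

  NoBasisContains : Fin n → Fin n → Fin n → Set
  NoBasisContains e f g = ∀ {B} → IsBasis M B → ¬ (e ∈ B × f ∈ B × g ∈ B)

  private
    variable
      B₁ B₂ X₁ X₂ : Subset n
      e f g : Fin n

  noBasisContains-swap : NoBasisContains e f g → NoBasisContains f e g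
  noBasisContains-swap noBasis isB (f∈B , e∈B , g∈B) = noBasis isB (e∈B , f∈B , g∈B)

  basis⊇eg⇒replace-f-by-g : NoBasisContains e f g → IsBasis M B₁ → e ∈ B₁ → f ∈ B₁ →
                            IsBasis M C → e ∈ C → g ∈ C → IsBasis M (replace B₁ f g)
  basis⊇eg⇒replace-f-by-g {e = e} {g = g} noBasis isB₁ e∈B₁ f∈B₁ isC e∈C g∈C
    with exchange-or-extend M isB₁ isC (⁅x⁆∪⁅y⁆⊆p e∈C g∈C) f∈B₁
  ... | inj₁ (C′ , isC′ , eg⊆C′ , f∈C′) =
    ⊥-elim (noBasis isC′ (eg⊆C′ (x∈⁅x⁆∪⁅y⁆ e g) , f∈C′ , eg⊆C′ (y∈⁅x⁆∪⁅y⁆ e g)))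
  ... | inj₂ (z , z∈eg , z∉B₁ , isB) with z∈⁅x⁆∪⁅y⁆⁻ z∈eg
  ...   | inj₁ refl = contradiction e∈B₁ z∉B₁
  ...   | inj₂ refl = isB

  replace-e-or-f-by-g : NoBasisContains e f g → IsBasis M B₁ → e ∈ B₁ → f ∈ B₁ →
                        IsBasis M B₂ → g ∈ B₂ →
                        IsBasis M (replace B₁ e g) ⊎ IsBasis M (replace B₁ f g)
  replace-e-or-f-by-g {g = g} noBasis isB₁ e∈B₁ f∈B₁ isB₂ g∈B₂
    with exchange-or-extend M isB₁ isB₂ (x∈p⇒⁅x⁆⊆p g∈B₂) e∈B₁
  ... | inj₁ (C′ , isC′ , g⊆C′ , e∈C′) =
    inj₂ (basis⊇eg⇒replace-f-by-g noBasis isB₁ e∈B₁ f∈B₁ isC′ e∈C′ (g⊆C′ (x∈⁅x⁆ g)))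
  ... | inj₂ (z , z∈⁅g⁆ , _ , isB) rewrite x∈⁅y⁆⇒x≡y g z∈⁅g⁆ = inj₁ isB

  replace-g-by-e-or-f : NoBasisContains e f g → IsBasis M B₁ → e ∈ B₁ → f ∈ B₁ →
                        IsBasis M B₂ → g ∈ B₂ →
                        IsBasis M (replace B₂ g e) ⊎ IsBasis M (replace B₂ g f)
  replace-g-by-e-or-f {e = e} {f = f} noBasis isB₁ e∈B₁ f∈B₁ isB₂ g∈B₂
    with exchange-or-extend M isB₂ isB₁ (⁅x⁆∪⁅y⁆⊆p e∈B₁ f∈B₁) g∈B₂
  ... | inj₁ (C′ , isC′ , ef⊆C′ , g∈C′) =
    ⊥-elim (noBasis isC′ (ef⊆C′ (x∈⁅x⁆∪⁅y⁆ e f) , ef⊆C′ (y∈⁅x⁆∪⁅y⁆ e f) , g∈C′))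
  ... | inj₂ (z , z∈ef , _ , isB) with z∈⁅x⁆∪⁅y⁆⁻ z∈ef
  ...   | inj₁ refl = inj₁ isB
  ...   | inj₂ refl = inj₂ isB

  replace-g-by-f-or-e-by-g : NoBasisContains e f g → IsBasis M B₁ → e ∈ B₁ → f ∈ B₁ →
                             IsBasis M B₂ → g ∈ B₂ →
                             IsBasis M (replace B₂ g f) ⊎ IsBasis M (replace B₁ e g)
  replace-g-by-f-or-e-by-g {f = f} noBasis isB₁ e∈B₁ f∈B₁ isB₂ g∈B₂
    with exchange-or-extend M isB₂ isB₁ (x∈p⇒⁅x⁆⊆p f∈B₁) g∈B₂
  ... | inj₁ (C′ , isC′ , f⊆C′ , g∈C′) = inj₂
    (basis⊇eg⇒replace-f-by-g (noBasisContains-swap noBasis) isB₁ f∈B₁ e∈B₁ isC′ (f⊆C′ (x∈⁅x⁆ f)) g∈C′)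
  ... | inj₂ (z , z∈⁅f⁆ , _ , isB) rewrite x∈⁅y⁆⇒x≡y f z∈⁅f⁆ = inj₁ isB

  -- Each of the two instances of replace-g-by-f-or-e-by-g yields the matching exchange of B₂
  -- or the other exchange of B₁; two exchanges of B₂ are completed by replace-e-or-f-by-g,
  -- two exchanges of B₁ by replace-g-by-e-or-f.
  two-exchange : NoBasisContains e f g → IsBasis M B₁ → e ∈ B₁ → f ∈ B₁ →
                 IsBasis M B₂ → g ∈ B₂ →
                 (IsBasis M (replace B₁ e g) × IsBasis M (replace B₂ g e)) ⊎
                 (IsBasis M (replace B₁ f g) × IsBasis M (replace B₂ g f))
  two-exchange noBasis isB₁ e∈B₁ f∈B₁ isB₂ g∈B₂
    with replace-g-by-f-or-e-by-g noBasis isB₁ e∈B₁ f∈B₁ isB₂ g∈B₂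
       | replace-g-by-f-or-e-by-g (noBasisContains-swap noBasis) isB₁ f∈B₁ e∈B₁ isB₂ g∈B₂
  ... | inj₂ B₁[e↦g] | inj₁ B₂[g↦e] = inj₁ (B₁[e↦g] , B₂[g↦e])
  ... | inj₁ B₂[g↦f] | inj₂ B₁[f↦g] = inj₂ (B₁[f↦g] , B₂[g↦f])
  ... | inj₁ B₂[g↦f] | inj₁ B₂[g↦e] =
    [ (λ B₁[e↦g] → inj₁ (B₁[e↦g] , B₂[g↦e])) , (λ B₁[f↦g] → inj₂ (B₁[f↦g] , B₂[g↦f])) ]
      (replace-e-or-f-by-g noBasis isB₁ e∈B₁ f∈B₁ isB₂ g∈B₂)
  ... | inj₂ B₁[e↦g] | inj₂ B₁[f↦g] =
    [ (λ B₂[g↦e] → inj₁ (B₁[e↦g] , B₂[g↦e])) , (λ B₂[g↦f] → inj₂ (B₁[f↦g] , B₂[g↦f])) ]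
      (replace-g-by-e-or-f noBasis isB₁ e∈B₁ f∈B₁ isB₂ g∈B₂)

  two-exchange-∪ : NoBasisContains e f g → e ≢ f → e ∉ X₁ → f ∉ X₁ → g ∉ X₂ →
    IsBasis M (X₁ ∪ ⁅ e ⁆ ∪ ⁅ f ⁆) → IsBasis M (X₂ ∪ ⁅ g ⁆) →
    (IsBasis M (X₁ ∪ ⁅ f ⁆ ∪ ⁅ g ⁆) × IsBasis M (X₂ ∪ ⁅ e ⁆)) ⊎
    (IsBasis M (X₁ ∪ ⁅ e ⁆ ∪ ⁅ g ⁆) × IsBasis M (X₂ ∪ ⁅ f ⁆))
  two-exchange-∪ {e = e} {f = f} {g = g} noBasis e≢f e∉X₁ f∉X₁ g∉X₂ isB₁ isB₂ = Sum.map
    (Product.map (subst (IsBasis M) (replace-∪⁅x⁆∪⁅y⁆ˡ e∉X₁ e≢f))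
                 (subst (IsBasis M) (replace-∪⁅x⁆ g∉X₂)))
    (Product.map (subst (IsBasis M) (replace-∪⁅x⁆∪⁅y⁆ʳ f∉X₁ e≢f))
                 (subst (IsBasis M) (replace-∪⁅x⁆ g∉X₂)))
    (two-exchange noBasis isB₁ (x∈p∪q⁺ (inj₂ (x∈⁅x⁆∪⁅y⁆ e f))) (x∈p∪q⁺ (inj₂ (y∈⁅x⁆∪⁅y⁆ e f)))
                  isB₂ (x∈p∪q⁺ (inj₂ (x∈⁅x⁆ g))))

-- Rank

module _ {A : Set} (f : A → ℕ) where

  foldr-⊔-upper : ∀ {x} xs → x ∈ˡ xs → f x ℕ.≤ foldr (λ x m → f x ⊔ m) 0 xs
  foldr-⊔-upper (y List.∷ xs) (Any.here refl)   = ℕ.m≤m⊔n (f y) _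
  foldr-⊔-upper (y List.∷ xs) (Any.there x∈xs) = ℕ.≤-trans (foldr-⊔-upper xs x∈xs) (ℕ.m≤n⊔m (f y) _)

  foldr-⊔-least : ∀ {k} xs → (∀ {x} → x ∈ˡ xs → f x ℕ.≤ k) → foldr (λ x m → f x ⊔ m) 0 xs ℕ.≤ k
  foldr-⊔-least List.[]        _     = z≤n
  foldr-⊔-least (y List.∷ xs) bound =
    ℕ.⊔-lub (bound (Any.here refl)) (foldr-⊔-least xs (bound ∘ Any.there))

  foldr-⊔-sel : ∀ xs → foldr (λ x m → f x ⊔ m) 0 xs ≡ 0 ⊎
                       ∃ λ x → x ∈ˡ xs × foldr (λ x m → f x ⊔ m) 0 xs ≡ f x
  foldr-⊔-sel List.[]        = inj₁ refl
  foldr-⊔-sel (y List.∷ xs) with ℕ.⊔-sel (f y) (foldr (λ x m → f x ⊔ m) 0 xs)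
  ... | inj₁ ≡fy = inj₂ (y , Any.here refl , ≡fy)
  ... | inj₂ ≡rest with foldr-⊔-sel xs
  ...   | inj₁ ≡0 = inj₁ (trans ≡rest ≡0)
  ...   | inj₂ (x , x∈xs , ≡fx) = inj₂ (x , Any.there x∈xs , trans ≡rest ≡fx)

allSubsets-complete : ∀ (B : Subset n) → B ∈ˡ allSubsets n
allSubsets-complete [] = Any.here refl
allSubsets-complete {suc n} (false ∷ B) = ∈-++⁺ˡ (∈-map⁺ (false ∷_) (allSubsets-complete B))
allSubsets-complete {suc n} (true ∷ B) =
  ∈-++⁺ʳ (map (false ∷_) (allSubsets n)) (∈-map⁺ (true ∷_) (allSubsets-complete B))

module _ (M : Matroid n) where

  private
    variable
      B₀ S X : Subset n
      g : Fin n

    basis∈basesOf : IsBasis M B → B ∈ˡ basesOf (isBasis M)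
    basis∈basesOf {B} = ∈-filter⁺ (T? ∘ isBasis M) (allSubsets-complete B)

    ∈basesOf⇒basis : B ∈ˡ basesOf (isBasis M) → IsBasis M B
    ∈basesOf⇒basis B∈ = proj₂ (∈-filter⁻ (T? ∘ isBasis M) {xs = allSubsets n} B∈)

  ∣B∩S∣≤rank : IsBasis M B → ∣ B ∩ S ∣ ℕ.≤ rank M S
  ∣B∩S∣≤rank {S = S} isB = foldr-⊔-upper (λ B → ∣ B ∩ S ∣) _ (basis∈basesOf isB)

  rank-least : ∀ {k} S → (∀ {B} → IsBasis M B → ∣ B ∩ S ∣ ℕ.≤ k) → rank M S ℕ.≤ k
  rank-least S bound = foldr-⊔-least (λ B → ∣ B ∩ S ∣) _ (bound ∘ ∈basesOf⇒basis)

  rank-attained : ∀ S → ∃ λ B → IsBasis M B × rank M S ℕ.≤ ∣ B ∩ S ∣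
  rank-attained S with foldr-⊔-sel (λ B → ∣ B ∩ S ∣) (basesOf (isBasis M))
  ... | inj₁ ≡0 = let B , isB = nonempty M in B , isB , subst (ℕ._≤ ∣ B ∩ S ∣) (sym ≡0) z≤n
  ... | inj₂ (B , B∈ , ≡∣B∩S∣) = B , ∈basesOf⇒basis B∈ , ℕ.≤-reflexive ≡∣B∩S∣

  rank≤∣∣ : ∀ S → rank M S ℕ.≤ ∣ S ∣
  rank≤∣∣ S = rank-least S λ {B} _ → ∣p∩q∣≤∣q∣ B S

  rank-⊥ : rank M ⊥ ≡ 0
  rank-⊥ = ℕ.n≤0⇒n≡0 (ℕ.≤-trans (rank≤∣∣ ⊥) (ℕ.≤-reflexive (∣⊥∣≡0 n)))

  ⊆basis⇒∣∣≤rank : IsBasis M B → S ⊆ B → ∣ S ∣ ℕ.≤ rank M S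
  ⊆basis⇒∣∣≤rank isB S⊆B =
    ℕ.≤-trans (p⊆q⇒∣p∣≤∣q∣ λ x∈S → x∈p∩q⁺ (S⊆B x∈S , x∈S)) (∣B∩S∣≤rank isB)

  rank-⊇basis : IsBasis M B → B ⊆ S → rank M S ≡ ∣ B ∣
  rank-⊇basis {B} {S} isB B⊆S = ℕ.≤-antisym
    (rank-least S λ {B′} isB′ →
      ℕ.≤-trans (∣p∩q∣≤∣p∣ B′ S) (ℕ.≤-reflexive (bases-equicardinal M isB′ isB)))
    (ℕ.≤-trans (p⊆q⇒∣p∣≤∣q∣ λ x∈B → x∈p∩q⁺ (x∈B , B⊆S x∈B)) (∣B∩S∣≤rank isB))

  full-rank⇒basis : IsBasis M B₀ → rank M X ≡ ∣ X ∣ → ∣ X ∣ ≡ ∣ B₀ ∣ → IsBasis M X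
  full-rank⇒basis {B₀} {X} isB₀ r≡∣X∣ ∣X∣≡∣B₀∣ with rank-attained X
  ... | B , isB , r≤∣B∩X∣ = subst (IsBasis M) (sym X≡B) isB
    where
    B∩X≡X : B ∩ X ≡ X
    B∩X≡X = ⊆∧∣∣≥⇒≡ (p∩q⊆q B X) (subst (ℕ._≤ ∣ B ∩ X ∣) r≡∣X∣ r≤∣B∩X∣)
    X≡B : X ≡ B
    X≡B = ⊆∧∣∣≥⇒≡ (λ x∈X → p∩q⊆p B X (subst (_ ∈_) (sym B∩X≡X) x∈X))
                   (ℕ.≤-reflexive (trans (bases-equicardinal M isB isB₀) (sym ∣X∣≡∣B₀∣)))

  rank-∪-strict : x ∉ S → IsBasis M B → S ∪ ⁅ x ⁆ ⊆ B → rank M S ℕ.< rank M (S ∪ ⁅ x ⁆)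
  rank-∪-strict {x} {S} x∉S isB S∪⁅x⁆⊆B = begin-strict
    rank M S           ≤⟨ rank≤∣∣ S ⟩
    ∣ S ∣              <⟨ ℕ.n<1+n _ ⟩
    suc ∣ S ∣          ≡⟨ ∣p∪⁅x⁆∣≡1+∣p∣ S x∉S ⟨
    ∣ S ∪ ⁅ x ⁆ ∣      ≤⟨ ⊆basis⇒∣∣≤rank isB S∪⁅x⁆⊆B ⟩
    rank M (S ∪ ⁅ x ⁆) ∎
    where open ℕ.≤-Reasoning

  deletion-isBasis : IsBasis M B₀ → g ∉ B₀ →
                     ∀ X → minorBasis M ⊥ ⁅ g ⁆ X ≡ isBasis M X ∧ not (lookup X g)
  deletion-isBasis {B₀} {g} isB₀ g∉B₀ X
    rewrite ∪-identityˡ ⁅ g ⁆ | ∪-identityʳ X | rank-⊥ | ℕ.+-identityʳ ∣ X ∣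
          | rank-⊇basis isB₀ (⊆∁⁅x⁆ g∉B₀) | ⊆ᵇ-∁ X ⁅ g ⁆ | disjointᵇ-⁅x⁆ X g
    = trans (cong (not (lookup X g) ∧_) (T-injective full-rank basis⇒full-rank))
            (∧-comm (not (lookup X g)) (isBasis M X))
    where
    full-rank : T ((rank M X ≡ᵇ ∣ X ∣) ∧ (∣ X ∣ ≡ᵇ ∣ B₀ ∣)) → IsBasis M X
    full-rank t = let r≡ , ∣∣≡ = Equivalence.to T-∧ t in
      full-rank⇒basis isB₀ (ℕ.≡ᵇ⇒≡ _ _ r≡) (ℕ.≡ᵇ⇒≡ _ _ ∣∣≡)
    basis⇒full-rank : IsBasis M X → T ((rank M X ≡ᵇ ∣ X ∣) ∧ (∣ X ∣ ≡ᵇ ∣ B₀ ∣))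
    basis⇒full-rank isX = Equivalence.from T-∧
      (ℕ.≡⇒≡ᵇ _ _ (rank-⊇basis isX ⊆-refl) , ℕ.≡⇒≡ᵇ _ _ (bases-equicardinal M isX isB₀))

+-nonneg : ∀ {p q} → 0ℚ ≤ p → 0ℚ ≤ q → 0ℚ ≤ p + q
+-nonneg = +-mono-≤

*-nonneg : ∀ {p q} → 0ℚ ≤ p → 0ℚ ≤ q → 0ℚ ≤ p * q
*-nonneg {p} {q} 0≤p 0≤q =
  nonNegative⁻¹ _ {{nonNeg*nonNeg⇒nonNeg p {{nonNegative 0≤p}} q {{nonNegative 0≤q}}}}

*-pos : ∀ {p q} → 0ℚ < p → 0ℚ < q → 0ℚ < p * q
*-pos {p} {q} 0<p 0<q = positive⁻¹ _ {{pos*pos⇒pos p {{positive 0<p}} q {{positive 0<q}}}}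

p≤q⇒0≤q-p : ∀ {p q} → p ≤ q → 0ℚ ≤ q - p
p≤q⇒0≤q-p {p} {q} p≤q = subst (_≤ q - p) (+-inverseʳ p) (+-monoˡ-≤ (- p) p≤q)

p≤p+q : ∀ {p q} → 0ℚ ≤ q → p ≤ p + q
p≤p+q {p} {q} 0≤q = subst (_≤ p + q) (+-identityʳ p) (+-mono-≤ (≤-refl {p}) 0≤q)

p≤q+p : ∀ {p q} → 0ℚ ≤ q → p ≤ q + p
p≤q+p {p} {q} 0≤q = subst (_≤ q + p) (+-identityˡ p) (+-mono-≤ 0≤q (≤-refl {p}))

if-nonneg : ∀ b {x} → 0ℚ ≤ x → 0ℚ ≤ (if b then x else 0ℚ)
if-nonneg true  0≤x = 0≤x
if-nonneg false _   = ≤-refl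

if-true : ∀ {b} {x : ℚ} → T b → (if b then x else 0ℚ) ≡ x
if-true {true} _ = refl

if-product-bound : ∀ u₁ u₂ v₁ v₂ w₁ w₂ {m₁ m₂ : ℚ} → 0ℚ ≤ m₁ → 0ℚ ≤ m₂ →
  (T u₁ → T u₂ → (T v₁ × T v₂) ⊎ (T w₁ × T w₂)) →
  (if u₁ then m₁ else 0ℚ) * (if u₂ then m₂ else 0ℚ) ≤
  (if v₁ then m₁ else 0ℚ) * (if v₂ then m₂ else 0ℚ) + (if w₁ then m₁ else 0ℚ) * (if w₂ then m₂ else 0ℚ)
if-product-bound u₁ u₂ v₁ v₂ w₁ w₂ {m₁} {m₂} 0≤m₁ 0≤m₂ = go u₁ u₂
  where
  V W : ℚ
  V = (if v₁ then m₁ else 0ℚ) * (if v₂ then m₂ else 0ℚ)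
  W = (if w₁ then m₁ else 0ℚ) * (if w₂ then m₂ else 0ℚ)
  0≤V : 0ℚ ≤ V
  0≤V = *-nonneg (if-nonneg v₁ 0≤m₁) (if-nonneg v₂ 0≤m₂)
  0≤W : 0ℚ ≤ W
  0≤W = *-nonneg (if-nonneg w₁ 0≤m₁) (if-nonneg w₂ 0≤m₂)
  go : ∀ u₁ u₂ → (T u₁ → T u₂ → (T v₁ × T v₂) ⊎ (T w₁ × T w₂)) →
       (if u₁ then m₁ else 0ℚ) * (if u₂ then m₂ else 0ℚ) ≤ V + W
  go false u₂ _ = subst (_≤ V + W) (sym (*-zeroˡ (if u₂ then m₂ else 0ℚ))) (+-nonneg 0≤V 0≤W)
  go true false _ = subst (_≤ V + W) (sym (*-zeroʳ m₁)) (+-nonneg 0≤V 0≤W)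
  go true true guards with guards tt tt
  ... | inj₁ (v₁ , v₂) = subst (_≤ V + W) (cong₂ _*_ (if-true v₁) (if-true v₂)) (p≤p+q 0≤W)
  ... | inj₂ (w₁ , w₂) = subst (_≤ V + W) (cong₂ _*_ (if-true w₁) (if-true w₂)) (p≤q+p 0≤V)

∑ : (Subset n → ℚ) → ℚ
∑ {zero}  h = h []
∑ {suc n} h = ∑ (h ∘ (false ∷_)) + ∑ (h ∘ (true ∷_))

private
  variable
    h k : Subset n → ℚ

∑-cong : (∀ B → h B ≡ k B) → ∑ h ≡ ∑ k
∑-cong {zero}  h≡k = h≡k []
∑-cong {suc n} h≡k = cong₂ _+_ (∑-cong (h≡k ∘ (false ∷_))) (∑-cong (h≡k ∘ (true ∷_)))

∑-zero : ∑ {n} (λ _ → 0ℚ) ≡ 0ℚ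
∑-zero {zero}  = refl
∑-zero {suc n} = trans (cong₂ _+_ (∑-zero {n}) (∑-zero {n})) (+-identityˡ 0ℚ)

∑-+ : ∀ (h k : Subset n → ℚ) → ∑ (λ B → h B + k B) ≡ ∑ h + ∑ k
∑-+ {zero}  h k = refl
∑-+ {suc n} h k = trans
  (cong₂ _+_ (∑-+ (h ∘ (false ∷_)) (k ∘ (false ∷_))) (∑-+ (h ∘ (true ∷_)) (k ∘ (true ∷_))))
  (interchange (∑ (h ∘ (false ∷_))) (∑ (k ∘ (false ∷_))) (∑ (h ∘ (true ∷_))) (∑ (k ∘ (true ∷_))))
  where
  open ℚSolver.+-*-Solver
  interchange : ∀ a b c d → (a + b) + (c + d) ≡ (a + c) + (b + d)
  interchange = solve 4 (λ a b c d → (a :+ b) :+ (c :+ d) := (a :+ c) :+ (b :+ d)) refl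

∑-*ˡ : ∀ c (h : Subset n → ℚ) → ∑ (λ B → c * h B) ≡ c * ∑ h
∑-*ˡ {zero}  c h = refl
∑-*ˡ {suc n} c h = trans (cong₂ _+_ (∑-*ˡ c (h ∘ (false ∷_))) (∑-*ˡ c (h ∘ (true ∷_))))
                         (sym (*-distribˡ-+ c _ _))

∑-mono : (∀ B → h B ≤ k B) → ∑ h ≤ ∑ k
∑-mono {zero}  h≤k = h≤k []
∑-mono {suc n} h≤k = +-mono-≤ (∑-mono (h≤k ∘ (false ∷_))) (∑-mono (h≤k ∘ (true ∷_)))

∑-nonneg : (∀ B → 0ℚ ≤ h B) → 0ℚ ≤ ∑ h
∑-nonneg {n} {h} 0≤h = subst (_≤ ∑ h) (∑-zero {n}) (∑-mono 0≤h)

∑*∑ : ∀ (h k : Subset n → ℚ) → ∑ h * ∑ k ≡ ∑ (λ B → ∑ (λ B′ → h B * k B′))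
∑*∑ h k = begin
  ∑ h * ∑ k                        ≡⟨ *-comm (∑ h) (∑ k) ⟩
  ∑ k * ∑ h                        ≡⟨ ∑-*ˡ (∑ k) h ⟨
  ∑ (λ B → ∑ k * h B)              ≡⟨ ∑-cong (λ B → *-comm (∑ k) (h B)) ⟩
  ∑ (λ B → h B * ∑ k)              ≡⟨ ∑-cong (λ B → ∑-*ˡ (h B) k) ⟨
  ∑ (λ B → ∑ (λ B′ → h B * k B′))  ∎
  where open ≡-Reasoning

∑*∑-bound : ∀ (f₁ f₂ g₁ g₂ h₁ h₂ : Subset n → ℚ) →
            (∀ B B′ → f₁ B * f₂ B′ ≤ g₁ B * g₂ B′ + h₁ B * h₂ B′) →
            ∑ f₁ * ∑ f₂ ≤ ∑ g₁ * ∑ g₂ + ∑ h₁ * ∑ h₂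
∑*∑-bound f₁ f₂ g₁ g₂ h₁ h₂ bound = subst₂ _≤_ (sym (∑*∑ f₁ f₂)) (sym rhs)
  (∑-mono λ B → ∑-mono λ B′ → bound B B′)
  where
  open ≡-Reasoning
  rhs : ∑ g₁ * ∑ g₂ + ∑ h₁ * ∑ h₂ ≡ ∑ (λ B → ∑ (λ B′ → g₁ B * g₂ B′ + h₁ B * h₂ B′))
  rhs = begin
    ∑ g₁ * ∑ g₂ + ∑ h₁ * ∑ h₂
      ≡⟨ cong₂ _+_ (∑*∑ g₁ g₂) (∑*∑ h₁ h₂) ⟩
    ∑ (λ B → ∑ (λ B′ → g₁ B * g₂ B′)) + ∑ (λ B → ∑ (λ B′ → h₁ B * h₂ B′))
      ≡⟨ ∑-+ (λ B → ∑ (λ B′ → g₁ B * g₂ B′)) (λ B → ∑ (λ B′ → h₁ B * h₂ B′)) ⟨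
    ∑ (λ B → ∑ (λ B′ → g₁ B * g₂ B′) + ∑ (λ B′ → h₁ B * h₂ B′))
      ≡⟨ ∑-cong (λ B → ∑-+ (λ B′ → g₁ B * g₂ B′) (λ B′ → h₁ B * h₂ B′)) ⟨
    ∑ (λ B → ∑ (λ B′ → g₁ B * g₂ B′ + h₁ B * h₂ B′)) ∎

sumℚ-++ : ∀ (xs ys : List ℚ) → sumℚ (xs ++ ys) ≡ sumℚ xs + sumℚ ys
sumℚ-++ List.[]        ys = sym (+-identityˡ _)
sumℚ-++ (x List.∷ xs) ys = trans (cong (x +_) (sumℚ-++ xs ys)) (sym (+-assoc x _ _))

sumℚ-filterᵇ : ∀ {A : Set} (p : A → Bool) (f : A → ℚ) xs →
               sumℚ (map f (filterᵇ p xs)) ≡ sumℚ (map (λ x → if p x then f x else 0ℚ) xs)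
sumℚ-filterᵇ p f List.[]        = refl
sumℚ-filterᵇ p f (x List.∷ xs) with p x
... | true  = cong (f x +_) (sumℚ-filterᵇ p f xs)
... | false = trans (sumℚ-filterᵇ p f xs) (sym (+-identityˡ _))

sumℚ-allSubsets : ∀ (h : Subset n → ℚ) → sumℚ (map h (allSubsets n)) ≡ ∑ h
sumℚ-allSubsets {zero}  h = +-identityʳ (h [])
sumℚ-allSubsets {suc n} h = begin
  sumℚ (map h (map (false ∷_) Bs ++ map (true ∷_) Bs))
    ≡⟨ cong sumℚ (map-++ h (map (false ∷_) Bs) (map (true ∷_) Bs)) ⟩
  sumℚ (map h (map (false ∷_) Bs) ++ map h (map (true ∷_) Bs))
    ≡⟨ sumℚ-++ (map h (map (false ∷_) Bs)) (map h (map (true ∷_) Bs)) ⟩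
  sumℚ (map h (map (false ∷_) Bs)) + sumℚ (map h (map (true ∷_) Bs))
    ≡⟨ cong₂ (λ xs ys → sumℚ xs + sumℚ ys) (map-∘ Bs) (map-∘ Bs) ⟨
  sumℚ (map (h ∘ (false ∷_)) Bs) + sumℚ (map (h ∘ (true ∷_)) Bs)
    ≡⟨ cong₂ _+_ (sumℚ-allSubsets (h ∘ (false ∷_))) (sumℚ-allSubsets (h ∘ (true ∷_))) ⟩
  ∑ (h ∘ (false ∷_)) + ∑ (h ∘ (true ∷_)) ∎
  where
  open ≡-Reasoning
  Bs : List (Subset n)
  Bs = allSubsets n

-- The polynomials M_I^J

monomial-remove : ∀ (y : Fin n → ℚ) {x} X → x ∈ X → monomial y X ≡ y x * monomial y (X ─ ⁅ x ⁆)
monomial-remove y (true ∷ X) here = cong (λ Z → y zero * monomial (y ∘ suc) Z) (sym (p─⊥≡p X))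
monomial-remove y (false ∷ X) (there x∈X) = monomial-remove (y ∘ suc) X x∈X
monomial-remove y {suc x} (true ∷ X) (there x∈X) = begin
  y zero * monomial (y ∘ suc) X
    ≡⟨ cong (y zero *_) (monomial-remove (y ∘ suc) X x∈X) ⟩
  y zero * (y (suc x) * monomial (y ∘ suc) (X ─ ⁅ x ⁆))
    ≡⟨ solve 3 (λ a b c → a :* (b :* c) := b :* (a :* c)) refl (y zero) (y (suc x)) _ ⟩
  y (suc x) * (y zero * monomial (y ∘ suc) (X ─ ⁅ x ⁆)) ∎
  where
  open ≡-Reasoning
  open ℚSolver.+-*-Solver

monomial-pos : ∀ (y : Fin n → ℚ) → (∀ c → 0ℚ < y c) → ∀ X → 0ℚ < monomial y X
monomial-pos y 0<y []          = positive⁻¹ 1ℚ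
monomial-pos y 0<y (true ∷ X)  = *-pos (0<y zero) (monomial-pos (y ∘ suc) (0<y ∘ suc) X)
monomial-pos y 0<y (false ∷ X) = monomial-pos (y ∘ suc) (0<y ∘ suc) X

weight : (Subset n → Bool) → Subset n → Subset n → (Fin n → ℚ) → Subset n → ℚ
weight 𝓑 I J y B = if ((I ⊆ᵇ B) ∧ disjointᵇ B J) ∧ 𝓑 B then monomial y (B ─ I) else 0ℚ

MIJ≡∑weight : ∀ (𝓑 : Subset n → Bool) I J y → MIJ 𝓑 I J y ≡ ∑ (weight 𝓑 I J y)
MIJ≡∑weight {n} 𝓑 I J y =
  trans (sumℚ-filterᵇ (λ B → (I ⊆ᵇ B) ∧ disjointᵇ B J) (λ B → monomial y (B ─ I)) (basesOf 𝓑))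
  (trans (sumℚ-filterᵇ 𝓑 _ (allSubsets n))
  (trans (sumℚ-allSubsets {n} _)
         (∑-cong λ B → if-if (𝓑 B) ((I ⊆ᵇ B) ∧ disjointᵇ B J))))
  where
  if-if : ∀ a b {x} → (if a then (if b then x else 0ℚ) else 0ℚ) ≡ (if b ∧ a then x else 0ℚ)
  if-if true  true  = refl
  if-if true  false = refl
  if-if false true  = refl
  if-if false false = refl

-- B ↦ B ─ I is a bijection from {B | I ⊆ B, B ∩ J = ∅} onto {X | X ∩ (I ∪ J) = ∅},
-- with inverse X ↦ X ∪ I.
∑-reindex : ∀ (I J : Subset n) (p : Subset n → Bool) (h : Subset n → ℚ) → T (disjointᵇ I J) →
            ∑ (λ B → if ((I ⊆ᵇ B) ∧ disjointᵇ B J) ∧ p B then h (B ─ I) else 0ℚ) ≡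
            ∑ (λ X → if disjointᵇ X (I ∪ J) ∧ p (X ∪ I) then h X else 0ℚ)
∑-reindex []          []          p h _ = refl
∑-reindex {suc n} (true ∷ I) (false ∷ J) p h I#J =
  trans (+-comm (∑ {n} λ _ → 0ℚ) _)
        (cong (_+ ∑ {n} λ _ → 0ℚ) (∑-reindex I J (p ∘ (true ∷_)) (h ∘ (false ∷_)) I#J))
∑-reindex {suc n} (false ∷ I) (true ∷ J) p h I#J = cong₂ _+_
  (∑-reindex I J (p ∘ (false ∷_)) (h ∘ (false ∷_)) I#J)
  (trans (∑-cong λ B → cong (λ c → if c ∧ p (true ∷ B) then h (true ∷ (B ─ I)) else 0ℚ)
                                   (∧-zeroʳ (I ⊆ᵇ B)))
         (trans (∑-zero {n}) (sym (∑-zero {n}))))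
∑-reindex (false ∷ I) (false ∷ J) p h I#J = cong₂ _+_
  (∑-reindex I J (p ∘ (false ∷_)) (h ∘ (false ∷_)) I#J)
  (∑-reindex I J (p ∘ (true ∷_)) (h ∘ (true ∷_)) I#J)

MIJ-reindexed : ∀ (𝓑 : Subset n → Bool) I J y → T (disjointᵇ I J) →
                MIJ 𝓑 I J y ≡ ∑ (λ X → if disjointᵇ X (I ∪ J) ∧ 𝓑 (X ∪ I) then monomial y X else 0ℚ)
MIJ-reindexed 𝓑 I J y I#J = trans (MIJ≡∑weight 𝓑 I J y) (∑-reindex I J 𝓑 (monomial y) I#J)

MIJ-nonneg : ∀ (𝓑 : Subset n → Bool) I J y → (∀ c → 0ℚ < y c) → 0ℚ ≤ MIJ 𝓑 I J y
MIJ-nonneg 𝓑 I J y 0<y = subst (0ℚ ≤_) (sym (MIJ≡∑weight 𝓑 I J y))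
  (∑-nonneg λ B → if-nonneg _ (<⇒≤ (monomial-pos y 0<y (B ─ I))))

MIJ-vanishes : ∀ (𝓑 : Subset n → Bool) I J y → (∀ {B} → T (𝓑 B) → ¬ I ⊆ B) → MIJ 𝓑 I J y ≡ 0ℚ
MIJ-vanishes {n} 𝓑 I J y noBasis⊇I =
  trans (MIJ≡∑weight 𝓑 I J y) (trans (∑-cong weight≡0) (∑-zero {n}))
  where
  weight≡0 : ∀ B → weight 𝓑 I J y B ≡ 0ℚ
  weight≡0 B with ((I ⊆ᵇ B) ∧ disjointᵇ B J) ∧ 𝓑 B in guard
  ... | false = refl
  ... | true  = let I⊆B∧B#J , 𝓑B = Equivalence.to T-∧ (subst T (sym guard) _) in
    ⊥-elim (noBasis⊇I 𝓑B (⊆ᵇ-sound I B (proj₁ (Equivalence.to T-∧ I⊆B∧B#J))))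

MIJ-deletion-contraction : ∀ (𝓑 : Subset n → Bool) I J y {g} → g ∉ I →
  MIJ 𝓑 I J y ≡ MIJ 𝓑 I (J ∪ ⁅ g ⁆) y + y g * MIJ 𝓑 (I ∪ ⁅ g ⁆) J y
MIJ-deletion-contraction 𝓑 I J y {g} g∉I = begin
  MIJ 𝓑 I J y
    ≡⟨ MIJ≡∑weight 𝓑 I J y ⟩
  ∑ (weight 𝓑 I J y)
    ≡⟨ ∑-cong split ⟩
  ∑ (λ B → weight 𝓑 I (J ∪ ⁅ g ⁆) y B + y g * weight 𝓑 (I ∪ ⁅ g ⁆) J y B)
    ≡⟨ ∑-+ (weight 𝓑 I (J ∪ ⁅ g ⁆) y) (λ B → y g * weight 𝓑 (I ∪ ⁅ g ⁆) J y B) ⟩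
  ∑ (weight 𝓑 I (J ∪ ⁅ g ⁆) y) + ∑ (λ B → y g * weight 𝓑 (I ∪ ⁅ g ⁆) J y B)
    ≡⟨ cong₂ _+_ (MIJ≡∑weight 𝓑 I (J ∪ ⁅ g ⁆) y)
                 (trans (cong (y g *_) (MIJ≡∑weight 𝓑 (I ∪ ⁅ g ⁆) J y))
                        (sym (∑-*ˡ (y g) (weight 𝓑 (I ∪ ⁅ g ⁆) J y)))) ⟨
  MIJ 𝓑 I (J ∪ ⁅ g ⁆) y + y g * MIJ 𝓑 (I ∪ ⁅ g ⁆) J y ∎
  where
  open ≡-Reasoning
  open BoolSolver.∨-∧-Solver
  if-split : ∀ G b {x x′ c : ℚ} → (T b → x ≡ c * x′) →
             (if G then x else 0ℚ) ≡ (if G ∧ not b then x else 0ℚ) + c * (if G ∧ b then x′ else 0ℚ)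
  if-split false b     {c = c} _   = sym (trans (+-identityˡ _) (*-zeroʳ c))
  if-split true  false {x} {c = c} _ = sym (trans (cong (x +_) (*-zeroʳ c)) (+-identityʳ x))
  if-split true  true  x≡cx′ = trans (x≡cx′ _) (sym (+-identityˡ _))
  split : ∀ B → weight 𝓑 I J y B ≡ weight 𝓑 I (J ∪ ⁅ g ⁆) y B + y g * weight 𝓑 (I ∪ ⁅ g ⁆) J y B
  split B = trans (if-split G b {c = y g} monomial-contract)
    (cong₂ (λ c₁ c₂ → (if c₁ then monomial y (B ─ I) else 0ℚ) +
                      y g * (if c₂ then monomial y (B ─ (I ∪ ⁅ g ⁆)) else 0ℚ))
           (sym deleted-guard) (sym contracted-guard))
    where
    a d b G : Bool
    a = I ⊆ᵇ B
    d = disjointᵇ B J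
    b = lookup B g
    G = (a ∧ d) ∧ 𝓑 B
    deleted-guard : (a ∧ disjointᵇ B (J ∪ ⁅ g ⁆)) ∧ 𝓑 B ≡ G ∧ not b
    deleted-guard = trans
      (cong (λ d′ → (a ∧ d′) ∧ 𝓑 B) (trans (disjointᵇ-∪ʳ B J ⁅ g ⁆) (cong (d ∧_) (disjointᵇ-⁅x⁆ B g))))
      (solve 4 (λ a d nb β → (a :* (d :* nb)) :* β := ((a :* d) :* β) :* nb) refl a d (not b) (𝓑 B))
    contracted-guard : (((I ∪ ⁅ g ⁆) ⊆ᵇ B) ∧ d) ∧ 𝓑 B ≡ G ∧ b
    contracted-guard = trans
      (cong (λ a′ → (a′ ∧ d) ∧ 𝓑 B) (trans (∪-⊆ᵇ I ⁅ g ⁆ B) (cong (a ∧_) (⁅x⁆-⊆ᵇ g B))))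
      (solve 4 (λ a b d β → ((a :* b) :* d) :* β := ((a :* d) :* β) :* b) refl a b d (𝓑 B))
    monomial-contract : T b → monomial y (B ─ I) ≡ y g * monomial y (B ─ (I ∪ ⁅ g ⁆))
    monomial-contract g∈B = trans
      (monomial-remove y (B ─ I) (x∈p∧x∉q⇒x∈p─q (Equivalence.from ∈⇔lookup g∈B) g∉I))
      (cong (λ Z → y g * monomial y Z) (p─q─r≡p─q∪r B I ⁅ g ⁆))

MIJ-deletion : ∀ (𝓑 𝓑′ : Subset n → Bool) I J y {g} → (∀ X → 𝓑′ X ≡ 𝓑 X ∧ not (lookup X g)) →
               MIJ 𝓑′ I J y ≡ MIJ 𝓑 I (J ∪ ⁅ g ⁆) y
MIJ-deletion 𝓑 𝓑′ I J y {g} 𝓑′≡ = trans (MIJ≡∑weight 𝓑′ I J y)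
  (trans (∑-cong λ X → cong (λ c → if c then monomial y (X ─ I) else 0ℚ) (guard X))
         (sym (MIJ≡∑weight 𝓑 I (J ∪ ⁅ g ⁆) y)))
  where
  open BoolSolver.∨-∧-Solver
  guard : ∀ X → ((I ⊆ᵇ X) ∧ disjointᵇ X J) ∧ 𝓑′ X ≡ ((I ⊆ᵇ X) ∧ disjointᵇ X (J ∪ ⁅ g ⁆)) ∧ 𝓑 X
  guard X rewrite 𝓑′≡ X | disjointᵇ-∪ʳ X J ⁅ g ⁆ | disjointᵇ-⁅x⁆ X g =
    solve 4 (λ a d β nb → (a :* d) :* (β :* nb) := (a :* (d :* nb)) :* β) refl
      (I ⊆ᵇ X) (disjointᵇ X J) (𝓑 X) (not (lookup X g))

key-inequality : ∀ (M : Matroid n) {e f g} → e ≢ f → e ≢ g → f ≢ g → NoBasisContains M e f g →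
  ∀ y → (∀ c → 0ℚ < y c) →
  MIJ (isBasis M) (⁅ e ⁆ ∪ ⁅ f ⁆) ⁅ g ⁆ y * MIJ (isBasis M) ⁅ g ⁆ (⁅ e ⁆ ∪ ⁅ f ⁆) y ≤
  MIJ (isBasis M) (⁅ f ⁆ ∪ ⁅ g ⁆) ⁅ e ⁆ y * MIJ (isBasis M) ⁅ e ⁆ (⁅ f ⁆ ∪ ⁅ g ⁆) y +
  MIJ (isBasis M) (⁅ e ⁆ ∪ ⁅ g ⁆) ⁅ f ⁆ y * MIJ (isBasis M) ⁅ f ⁆ (⁅ e ⁆ ∪ ⁅ g ⁆) y
key-inequality {n} M {e} {f} {g} e≢f e≢g f≢g noBasis y 0<y =
  subst₂ _≤_ (sym (cong₂ _*_ M-ef-g M-g-ef))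
             (sym (cong₂ _+_ (cong₂ _*_ M-fg-e M-e-fg) (cong₂ _*_ M-eg-f M-f-eg)))
    (∑*∑-bound (w (⁅ e ⁆ ∪ ⁅ f ⁆)) (w ⁅ g ⁆) (w (⁅ f ⁆ ∪ ⁅ g ⁆)) (w ⁅ e ⁆) (w (⁅ e ⁆ ∪ ⁅ g ⁆)) (w ⁅ f ⁆)
               pointwise)
  where
  open ∪-Solver (∪-idempotentCommutativeMonoid n)

  S : Subset n
  S = ⁅ e ⁆ ∪ ⁅ f ⁆ ∪ ⁅ g ⁆

  𝓜 : Subset n → Subset n → ℚ
  𝓜 I J = MIJ (isBasis M) I J y

  w : Subset n → Subset n → ℚ
  w I X = if disjointᵇ X S ∧ isBasis M (X ∪ I) then monomial y X else 0ℚ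

  reindexed : ∀ {I J} → (∀ {x} → x ∈ I → x ∉ J) → I ∪ J ≡ S → 𝓜 I J ≡ ∑ (w I)
  reindexed {I} {J} I#J I∪J≡S = trans (MIJ-reindexed (isBasis M) I J y (disjointᵇ-complete I J I#J))
    (∑-cong λ X → cong (λ S′ → if disjointᵇ X S′ ∧ isBasis M (X ∪ I) then monomial y X else 0ℚ) I∪J≡S)

  M-ef-g : 𝓜 (⁅ e ⁆ ∪ ⁅ f ⁆) ⁅ g ⁆ ≡ ∑ (w (⁅ e ⁆ ∪ ⁅ f ⁆))
  M-ef-g = reindexed (⁅x⁆∪⁅y⁆#⁅z⁆ e≢g f≢g)
    (solve 3 (λ e f g → (e ⊕ f) ⊕ g ⊜ e ⊕ (f ⊕ g)) refl ⁅ e ⁆ ⁅ f ⁆ ⁅ g ⁆)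
  M-g-ef : 𝓜 ⁅ g ⁆ (⁅ e ⁆ ∪ ⁅ f ⁆) ≡ ∑ (w ⁅ g ⁆)
  M-g-ef = reindexed (⁅x⁆#⁅y⁆∪⁅z⁆ (e≢g ∘ sym) (f≢g ∘ sym))
    (solve 3 (λ e f g → g ⊕ (e ⊕ f) ⊜ e ⊕ (f ⊕ g)) refl ⁅ e ⁆ ⁅ f ⁆ ⁅ g ⁆)
  M-fg-e : 𝓜 (⁅ f ⁆ ∪ ⁅ g ⁆) ⁅ e ⁆ ≡ ∑ (w (⁅ f ⁆ ∪ ⁅ g ⁆))
  M-fg-e = reindexed (⁅x⁆∪⁅y⁆#⁅z⁆ (e≢f ∘ sym) (e≢g ∘ sym))
    (solve 3 (λ e f g → (f ⊕ g) ⊕ e ⊜ e ⊕ (f ⊕ g)) refl ⁅ e ⁆ ⁅ f ⁆ ⁅ g ⁆)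
  M-e-fg : 𝓜 ⁅ e ⁆ (⁅ f ⁆ ∪ ⁅ g ⁆) ≡ ∑ (w ⁅ e ⁆)
  M-e-fg = reindexed (⁅x⁆#⁅y⁆∪⁅z⁆ e≢f e≢g) refl
  M-eg-f : 𝓜 (⁅ e ⁆ ∪ ⁅ g ⁆) ⁅ f ⁆ ≡ ∑ (w (⁅ e ⁆ ∪ ⁅ g ⁆))
  M-eg-f = reindexed (⁅x⁆∪⁅y⁆#⁅z⁆ e≢f (f≢g ∘ sym))
    (solve 3 (λ e f g → (e ⊕ g) ⊕ f ⊜ e ⊕ (f ⊕ g)) refl ⁅ e ⁆ ⁅ f ⁆ ⁅ g ⁆)
  M-f-eg : 𝓜 ⁅ f ⁆ (⁅ e ⁆ ∪ ⁅ g ⁆) ≡ ∑ (w ⁅ f ⁆)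
  M-f-eg = reindexed (⁅x⁆#⁅y⁆∪⁅z⁆ (e≢f ∘ sym) f≢g)
    (solve 3 (λ e f g → f ⊕ (e ⊕ g) ⊜ e ⊕ (f ⊕ g)) refl ⁅ e ⁆ ⁅ f ⁆ ⁅ g ⁆)

  ∉-of-disjoint : ∀ {X x} → T (disjointᵇ X S) → x ∈ S → x ∉ X
  ∉-of-disjoint {X} X#S x∈S x∈X = disjointᵇ-sound X S X#S x∈X x∈S

  e∈S : e ∈ S
  e∈S = x∈p∪q⁺ (inj₁ (x∈⁅x⁆ e))
  f∈S : f ∈ S
  f∈S = x∈p∪q⁺ (inj₂ (x∈⁅x⁆∪⁅y⁆ f g))
  g∈S : g ∈ S
  g∈S = x∈p∪q⁺ (inj₂ (y∈⁅x⁆∪⁅y⁆ f g))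

  pointwise : ∀ X₁ X₂ → w (⁅ e ⁆ ∪ ⁅ f ⁆) X₁ * w ⁅ g ⁆ X₂ ≤
                        w (⁅ f ⁆ ∪ ⁅ g ⁆) X₁ * w ⁅ e ⁆ X₂ + w (⁅ e ⁆ ∪ ⁅ g ⁆) X₁ * w ⁅ f ⁆ X₂
  pointwise X₁ X₂ = if-product-bound _ _ _ _ _ _
    (<⇒≤ (monomial-pos y 0<y X₁)) (<⇒≤ (monomial-pos y 0<y X₂)) guards
    where
    guards : T (disjointᵇ X₁ S ∧ isBasis M (X₁ ∪ ⁅ e ⁆ ∪ ⁅ f ⁆)) →
             T (disjointᵇ X₂ S ∧ isBasis M (X₂ ∪ ⁅ g ⁆)) →
             (T (disjointᵇ X₁ S ∧ isBasis M (X₁ ∪ ⁅ f ⁆ ∪ ⁅ g ⁆)) ×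
              T (disjointᵇ X₂ S ∧ isBasis M (X₂ ∪ ⁅ e ⁆))) ⊎
             (T (disjointᵇ X₁ S ∧ isBasis M (X₁ ∪ ⁅ e ⁆ ∪ ⁅ g ⁆)) ×
              T (disjointᵇ X₂ S ∧ isBasis M (X₂ ∪ ⁅ f ⁆)))
    guards t₁ t₂ =
      let X₁#S , isB₁ = Equivalence.to T-∧ t₁
          X₂#S , isB₂ = Equivalence.to T-∧ t₂
          pack₁ = λ {B} (isB : IsBasis M B) → Equivalence.from T-∧ (X₁#S , isB)
          pack₂ = λ {B} (isB : IsBasis M B) → Equivalence.from T-∧ (X₂#S , isB)
      in Sum.map (Product.map pack₁ pack₂) (Product.map pack₁ pack₂)
           (two-exchange-∪ M noBasis e≢f (∉-of-disjoint X₁#S e∈S) (∉-of-disjoint X₁#S f∈S)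
                                         (∉-of-disjoint X₂#S g∈S) isB₁ isB₂)

-- Nonnegativity of ΔM{e,f}

Δ-expansion-nonneg : ∀ {t a a′ b b′ c d d′} → 0ℚ ≤ t → 0ℚ ≤ a′ → 0ℚ ≤ b′ →
  0ℚ ≤ a * b - c * d → c * d′ ≤ b′ * a + a′ * b →
  0ℚ ≤ (a + t * a′) * (b + t * b′) - c * (d + t * d′)
Δ-expansion-nonneg {t} {a} {a′} {b} {b′} {c} {d} {d′} 0≤t 0≤a′ 0≤b′ 0≤ab-cd cd′≤ab′+a′b =
  subst (0ℚ ≤_) (sym expand)
    (+-nonneg (+-nonneg 0≤ab-cd (*-nonneg 0≤t (p≤q⇒0≤q-p cd′≤ab′+a′b)))
              (*-nonneg (*-nonneg 0≤t 0≤t) (*-nonneg 0≤a′ 0≤b′)))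
  where
  open ℚSolver.+-*-Solver
  expand : (a + t * a′) * (b + t * b′) - c * (d + t * d′) ≡
           ((a * b - c * d) + t * ((b′ * a + a′ * b) - c * d′)) + (t * t) * (a′ * b′)
  expand = solve 8 (λ t a a′ b b′ c d d′ →
      (a :+ t :* a′) :* (b :+ t :* b′) :- c :* (d :+ t :* d′) :=
      ((a :* b :- c :* d) :+ t :* ((b′ :* a :+ a′ :* b) :- c :* d′)) :+ (t :* t) :* (a′ :* b′))
    refl t a a′ b b′ c d d′

ΔM-nonneg-without-common-basis : ∀ (𝓑 : Subset n → Bool) e f y → (∀ c → 0ℚ < y c) →
  (∀ {B} → T (𝓑 B) → ¬ (e ∈ B × f ∈ B)) → 0ℚ ≤ ΔM 𝓑 e f y
ΔM-nonneg-without-common-basis 𝓑 e f y 0<y noBasis = subst (0ℚ ≤_) (sym Δ≡)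
  (*-nonneg (MIJ-nonneg 𝓑 ⁅ e ⁆ ⁅ f ⁆ y 0<y) (MIJ-nonneg 𝓑 ⁅ f ⁆ ⁅ e ⁆ y 0<y))
  where
  open ℚSolver.+-*-Solver
  M-ef≡0 : MIJ 𝓑 (⁅ e ⁆ ∪ ⁅ f ⁆) ⊥ y ≡ 0ℚ
  M-ef≡0 = MIJ-vanishes 𝓑 (⁅ e ⁆ ∪ ⁅ f ⁆) ⊥ y λ 𝓑B ef⊆B →
    noBasis 𝓑B (ef⊆B (x∈⁅x⁆∪⁅y⁆ e f) , ef⊆B (y∈⁅x⁆∪⁅y⁆ e f))
  Δ≡ : ΔM 𝓑 e f y ≡ MIJ 𝓑 ⁅ e ⁆ ⁅ f ⁆ y * MIJ 𝓑 ⁅ f ⁆ ⁅ e ⁆ y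
  Δ≡ = trans (cong (λ z → MIJ 𝓑 ⁅ e ⁆ ⁅ f ⁆ y * MIJ 𝓑 ⁅ f ⁆ ⁅ e ⁆ y - z * MIJ 𝓑 ⊥ (⁅ e ⁆ ∪ ⁅ f ⁆) y)
                   M-ef≡0)
             (solve 2 (λ p q → p :- con 0ℚ :* q := p) refl
               (MIJ 𝓑 ⁅ e ⁆ ⁅ f ⁆ y * MIJ 𝓑 ⁅ f ⁆ ⁅ e ⁆ y) (MIJ 𝓑 ⊥ (⁅ e ⁆ ∪ ⁅ f ⁆) y))

ΔM-nonneg-from-deletion : ∀ (M : Matroid n) {e f g B₀} → e ≢ f → e ≢ g → f ≢ g →
  NoBasisContains M e f g → IsBasis M B₀ → g ∉ B₀ → ∀ y → (∀ c → 0ℚ < y c) →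
  0ℚ ≤ ΔM (minorBasis M ⊥ ⁅ g ⁆) e f y → 0ℚ ≤ ΔM (isBasis M) e f y
ΔM-nonneg-from-deletion {n} M {e} {f} {g} e≢f e≢g f≢g noBasis isB₀ g∉B₀ y 0<y 0≤Δ′ =
  subst (0ℚ ≤_) (sym Δ≡)
    (Δ-expansion-nonneg {y g} {a} {a′} {b} {b′} {c} {d} {d′}
      (<⇒≤ (0<y g)) (MIJ-nonneg 𝓑 _ _ y 0<y) (MIJ-nonneg 𝓑 _ _ y 0<y)
      (subst (0ℚ ≤_) Δ′≡ 0≤Δ′) (key-inequality M e≢f e≢g f≢g noBasis y 0<y))
  where
  𝓑 : Subset n → Bool
  𝓑 = isBasis M
  ef : Subset n
  ef = ⁅ e ⁆ ∪ ⁅ f ⁆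
  a a′ b b′ c d d′ : ℚ
  a  = MIJ 𝓑 ⁅ e ⁆ (⁅ f ⁆ ∪ ⁅ g ⁆) y
  a′ = MIJ 𝓑 (⁅ e ⁆ ∪ ⁅ g ⁆) ⁅ f ⁆ y
  b  = MIJ 𝓑 ⁅ f ⁆ (⁅ e ⁆ ∪ ⁅ g ⁆) y
  b′ = MIJ 𝓑 (⁅ f ⁆ ∪ ⁅ g ⁆) ⁅ e ⁆ y
  c  = MIJ 𝓑 ef ⁅ g ⁆ y
  d  = MIJ 𝓑 ⊥ (ef ∪ ⁅ g ⁆) y
  d′ = MIJ 𝓑 ⁅ g ⁆ ef y

  dc : ∀ I J → g ∉ I → MIJ 𝓑 I J y ≡ MIJ 𝓑 I (J ∪ ⁅ g ⁆) y + y g * MIJ 𝓑 (I ∪ ⁅ g ⁆) J y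
  dc I J = MIJ-deletion-contraction 𝓑 I J y

  deleted : ∀ I J → MIJ (minorBasis M ⊥ ⁅ g ⁆) I J y ≡ MIJ 𝓑 I (J ∪ ⁅ g ⁆) y
  deleted I J = MIJ-deletion 𝓑 (minorBasis M ⊥ ⁅ g ⁆) I J y (deletion-isBasis M isB₀ g∉B₀)

  M-efg≡0 : MIJ 𝓑 (ef ∪ ⁅ g ⁆) ⊥ y ≡ 0ℚ
  M-efg≡0 = MIJ-vanishes 𝓑 (ef ∪ ⁅ g ⁆) ⊥ y λ isB efg⊆B →
    noBasis isB (efg⊆B (x∈p∪q⁺ (inj₁ (x∈⁅x⁆∪⁅y⁆ e f))) , efg⊆B (x∈p∪q⁺ (inj₁ (y∈⁅x⁆∪⁅y⁆ e f))) ,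
                 efg⊆B (x∈p∪q⁺ (inj₂ (x∈⁅x⁆ g))))

  M-ef≡c : MIJ 𝓑 ef ⊥ y ≡ c
  M-ef≡c = trans (dc ef ⊥ (x∉p∪q (x≢y⇒x∉⁅y⁆ (e≢g ∘ sym)) (x≢y⇒x∉⁅y⁆ (f≢g ∘ sym))))
    (trans (cong₂ (λ J z → MIJ 𝓑 ef J y + y g * z) (∪-identityˡ ⁅ g ⁆) M-efg≡0)
    (trans (cong (c +_) (*-zeroʳ (y g))) (+-identityʳ c)))

  M-none≡ : MIJ 𝓑 ⊥ ef y ≡ d + y g * d′
  M-none≡ = trans (dc ⊥ ef ∉⊥) (cong (λ I → d + y g * MIJ 𝓑 I ef y) (∪-identityˡ ⁅ g ⁆))

  Δ≡ : ΔM 𝓑 e f y ≡ (a + y g * a′) * (b + y g * b′) - c * (d + y g * d′)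
  Δ≡ = cong₂ _-_ (cong₂ _*_ (dc ⁅ e ⁆ ⁅ f ⁆ (x≢y⇒x∉⁅y⁆ (e≢g ∘ sym)))
                            (dc ⁅ f ⁆ ⁅ e ⁆ (x≢y⇒x∉⁅y⁆ (f≢g ∘ sym))))
                 (cong₂ _*_ M-ef≡c M-none≡)

  Δ′≡ : ΔM (minorBasis M ⊥ ⁅ g ⁆) e f y ≡ a * b - c * d
  Δ′≡ = cong₂ _-_ (cong₂ _*_ (deleted ⁅ e ⁆ ⁅ f ⁆) (deleted ⁅ f ⁆ ⁅ e ⁆))
                  (cong₂ _*_ (trans (deleted ef ⊥) (cong (λ J → MIJ 𝓑 ef J y) (∪-identityˡ ⁅ g ⁆)))
                             (deleted ⊥ ef))

proposition3p2 : ∀ {n : ℕ} (M : Matroid n) → ¬ Rayleigh M → ProperMinorsRayleigh M →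
  (e f : Fin n) → e ≢ f → (y : Fin n → ℚ) → (∀ c → 0ℚ < y c) → ΔM (isBasis M) e f y < 0ℚ →
  IsFlat M (⁅ e ⁆ ∪ ⁅ f ⁆)
proposition3p2 M _ minorsRayleigh e f e≢f y 0<y Δ<0 g g∉ef rank≡ = <-irrefl refl (≤-<-trans 0≤Δ Δ<0)
  where
  e≢g : e ≢ g
  e≢g refl = g∉ef (x∈⁅x⁆∪⁅y⁆ e f)
  f≢g : f ≢ g
  f≢g refl = g∉ef (y∈⁅x⁆∪⁅y⁆ e f)

  noBasis : NoBasisContains M e f g
  noBasis isB (e∈B , f∈B , g∈B) =
    ℕ.<-irrefl (sym rank≡) (rank-∪-strict M g∉ef isB (p∪q⊆r (⁅x⁆∪⁅y⁆⊆p e∈B f∈B) (x∈p⇒⁅x⁆⊆p g∈B)))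

  ∈∁⁅g⁆ : ∀ {x} → x ≢ g → x ∈ ∁ (⊥ ∪ ⁅ g ⁆)
  ∈∁⁅g⁆ x≢g = x∉p⇒x∈∁p (x∉p∪q ∉⊥ (x≢y⇒x∉⁅y⁆ x≢g))

  0≤Δ : 0ℚ ≤ ΔM (isBasis M) e f y
  0≤Δ with anySubset? (λ B → T? (isBasis M B) ×-dec (e ∈? B ×-dec f ∈? B))
  ... | no ∄ = ΔM-nonneg-without-common-basis (isBasis M) e f y 0<y λ isB e,f∈B → ∄ (_ , isB , e,f∈B)
  ... | yes (B₀ , isB₀ , e∈B₀ , f∈B₀) =
    ΔM-nonneg-from-deletion M e≢f e≢g f≢g noBasis isB₀ (λ g∈B₀ → noBasis isB₀ (e∈B₀ , f∈B₀ , g∈B₀)) y 0<y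
      (minorsRayleigh ⊥ ⁅ g ⁆ (disjointᵇ-complete ⊥ ⁅ g ⁆ (λ x∈⊥ _ → ∉⊥ x∈⊥))
                      (g , x∈p∪q⁺ (inj₂ (x∈⁅x⁆ g))) e f (∈∁⁅g⁆ e≢g) (∈∁⁅g⁆ f≢g) e≢f y 0<y)
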